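{- Let $n\ge4$, $S_n^D$, $T_n^D$, $\varphi$ and $\Xi_{D_n}$ be as follows, and let $\Xi^{n-1,n}$ be the set of $n$-tuples of transpositions of $\mathrm{Sym}([n])$ generating $\mathrm{Sym}([n])$. Then the map $\overline{\varphi}:\Xi_{D_n}\to\Xi^{n-1,n}$, $(t_1,\dots,t_n)\mapsto(\varphi(t_1),\dots,\varphi(t_n))$, is surjective.
   Context: $S_n^D$ is the subgroup of the signed permutation group $S_n^B=\{\pi\in\mathrm{Sym}([\pm n])\mid\pi(-i)=-\pi(i)\}$ generated by $T_n^D=\{(i,j)(-i,-j)\mid1\le i<|j|\le n\}$; $\varphi:S_n^D\to\mathrm{Sym}([n])$ is $\varphi(\pi)(k)=|\pi(k)|$, so $\varphi((i,j)(-i,-j))=\varphi((i,-j)(-i,j))=(i,j)$; $\Xi_{D_n}=\{(t_1,\dots,t_n)\mid t_i\in T_n^D,\ \langle t_1,\dots,t_n\rangle=S_n^D\}$. (The map $\overline\varphi$ is well defined, i.e. takes values in $\Xi^{n-1,n}$.) -}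

module Defs where

open import Data.Nat using (ℕ; _<_)
open import Data.Bool using (Bool; true; false; not; if_then_else_)
open import Data.Bool.Properties using () renaming (_≟_ to _≟B_)
open import Data.Fin using (Fin; toℕ)
open import Data.Fin.Properties using () renaming (_≟_ to _≟F_)
open import Data.Fin.Permutation.Components using (transpose)
open import Data.Product using (Σ; ∃; ∃-syntax; _×_; _,_; proj₂)
open import Data.Product.Properties using (≡-dec)
open import Relation.Nullary using (¬_; does)
open import Relation.Binary.PropositionalEquality using (_≡_; _≢_)
open import Function using (_∘_; id)

_≗_ : ∀ {A B : Set} → (A → B) → (A → B) → Set
f ≗ g = ∀ x → f x ≡ g x

IsBijection : ∀ {A : Set} → (A → A) → Set
IsBijection {A} f = Σ (A → A) λ g → (∀ x → g (f x) ≡ x) × (∀ x → f (g x) ≡ x)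

-- subgroup of Sym(A) generated by a set S of bijections (S given as a predicate);
-- elements are bijections considered up to pointwise equality
data Gen {A : Set} (S : (A → A) → Set) : (A → A) → Set where
  gen  : ∀ {f} → S f → Gen S f
  unit : Gen S id
  comp : ∀ {f g} → Gen S f → Gen S g → Gen S (f ∘ g)
  inv  : ∀ {f g} → Gen S f → (∀ x → g (f x) ≡ x) → (∀ x → f (g x) ≡ x) → Gen S g
  ext  : ∀ {f g} → Gen S f → f ≗ g → Gen S g

Entries : ∀ {m} {A : Set} → (Fin m → (A → A)) → (A → A) → Set
Entries {m} fs f = ∃[ k ] (fs k ≗ f)

IsTransposition : ∀ {n} → (Fin n → Fin n) → Set
IsTransposition {n} f = ∃[ i ] ∃[ j ] (i ≢ j × f ≗ transpose i j)

InXiSym : (n : ℕ) → (Fin n → (Fin n → Fin n)) → Set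
InXiSym n s = (∀ k → IsTransposition (s k))
            × (∀ g → IsBijection g → Gen (Entries s) g)

-- [±n] = {±1,...,±n}: (b , k) stands for -(k+1) if b = true, +(k+1) if b = false

Pt : ℕ → Set
Pt n = Bool × Fin n

neg : ∀ {n} → Pt n → Pt n
neg (b , k) = (not b , k)

_≟P_ : ∀ {n} (x y : Pt n) → Relation.Nullary.Dec (x ≡ y)
_≟P_ = ≡-dec _≟B_ _≟F_

swapPt : ∀ {n} → Pt n → Pt n → Pt n → Pt n
swapPt a b x = if does (x ≟P a) then b else (if does (x ≟P b) then a else x)

-- (i, j)(-i, -j) with j = +k (s = false) or j = -k (s = true)
tD : ∀ {n} → Fin n → Fin n → Bool → Pt n → Pt n
tD i k s = swapPt (false , i) (s , k) ∘ swapPt (true , i) (not s , k)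

InTD : ∀ {n} → (Pt n → Pt n) → Set
InTD {n} f = ∃[ i ] ∃[ k ] ∃[ s ] (toℕ i < toℕ k × f ≗ tD i k s)

InSD : ∀ {n} → (Pt n → Pt n) → Set
InSD = Gen InTD

InXiD : (n : ℕ) → (Fin n → (Pt n → Pt n)) → Set
InXiD n t = (∀ k → InTD (t k))
          × (∀ g → (InSD g → Gen (Entries t) g) × (Gen (Entries t) g → InSD g))

φ : ∀ {n} → (Pt n → Pt n) → Fin n → Fin n
φ π k = proj₂ (π (false , k))

-- The transpositions s k are the edges of a connected graph on [n] with n edges, so some
-- edge m lies on a cycle: its endpoints stay connected without it. Lift each s k = (i j),
-- i < j, to (i,j)(-i,-j), except s m, which is lifted to (i,-j)(-i,j). Along the graph
-- without m the unsigned lifts generate every (x,y)(-x,-y); composing one of them with the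
-- lift of s m gives the sign change on the pair {i,j}, and conjugating that by unsigned
-- transpositions gives the sign change on every pair. Together these generate all of T_n^D.
module Submission where

open import Defs
open import Data.Bool using (Bool; true; false; not; _∨_; _xor_; if_then_else_)
open import Data.Empty using (⊥-elim)
open import Data.Fin using (Fin; toℕ; fromℕ<) renaming (zero to fzero)
open import Data.Fin.Permutation.Components using (transpose)
open import Data.Fin.Properties using (_≟_; <-cmp; <⇒≢; toℕ-fromℕ<)
import Data.Fin.Subset as Subset
open import Data.Fin.Subset using (Subset; _∈_; _-_; ∣_∣)
open import Data.Fin.Subset.Properties using (∈⊤; ∣⊤∣≡n; x∈p∧x≢y⇒x∈p-y; x∈p⇒∣p-x∣<∣p∣)
open import Data.Nat using (ℕ; zero; suc; _+_; _≤_; _<_; z≤n)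
open import Data.Nat.Properties
  using (<-irrefl; <⇒≤; <⇒≱; ≤-<-trans; ≤-refl; ≤-reflexive; ≤-trans; m<n⇒m<1+n; n<1+n;
         +-suc; +-identityʳ; +-monoˡ-≤; +-cancelʳ-≤)
open import Data.Product using (Σ; ∃; _×_; _,_; proj₁; proj₂; map₂)
open import Data.Sum using (_⊎_; inj₁; inj₂)
open import Data.Unit using (⊤; tt)
open import Function using (_∘_; id; mk⇔)
open import Level using (0ℓ)
open import Relation.Binary using (Rel; _⇒_; IsEquivalence; DecidableEquality; tri<; tri≈; tri>)
open import Relation.Binary.Construct.Closure.Equivalence as EqClosure using (EqClosure; _⋆)
open import Relation.Binary.Construct.Closure.ReflexiveTransitive using (ε; _◅◅_)
open import Relation.Binary.PropositionalEquality
  using (_≡_; _≢_; refl; sym; trans; cong; cong₂; subst; subst₂; module ≡-Reasoning)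
open import Relation.Nullary using (yes; no; does)
open import Relation.Nullary.Decidable using (dec-true; dec-false; does-⇔)

module Swap {A : Set} (_≟ᴬ_ : DecidableEquality A) where

  swap : A → A → A → A
  swap a b x = if does (x ≟ᴬ a) then b else if does (x ≟ᴬ b) then a else x

  swap-a : ∀ a b → swap a b a ≡ b
  swap-a a b rewrite dec-true (a ≟ᴬ a) refl = refl

  swap-b : ∀ a b → swap a b b ≡ a
  swap-b a b with b ≟ᴬ a
  ... | yes refl = refl
  ... | no _ rewrite dec-true (b ≟ᴬ b) refl = refl

  swap-other : ∀ {a b x} → x ≢ a → x ≢ b → swap a b x ≡ x
  swap-other {a} {b} {x} x≢a x≢b rewrite dec-false (x ≟ᴬ a) x≢a | dec-false (x ≟ᴬ b) x≢b = refl

  data Position (a b : A) : A → Set where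
    at-a      : Position a b a
    at-b      : Position a b b
    elsewhere : ∀ {x} → x ≢ a → x ≢ b → Position a b x

  position : ∀ a b x → Position a b x
  position a b x with x ≟ᴬ a | x ≟ᴬ b
  ... | yes refl | _        = at-a
  ... | no _     | yes refl = at-b
  ... | no x≢a   | no x≢b   = elsewhere x≢a x≢b

  module _ {a b : A} where

    swap-involutive : ∀ x → swap a b (swap a b x) ≡ x
    swap-involutive x with position a b x
    ... | at-a              = trans (cong (swap a b) (swap-a a b)) (swap-b a b)
    ... | at-b              = trans (cong (swap a b) (swap-b a b)) (swap-a a b)
    ... | elsewhere x≢a x≢b = trans (cong (swap a b) (swap-other x≢a x≢b)) (swap-other x≢a x≢b)

    swap-comm : ∀ x → swap a b x ≡ swap b a x
    swap-comm x with position a b x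
    ... | at-a              = trans (swap-a a b) (sym (swap-b b a))
    ... | at-b              = trans (swap-b a b) (sym (swap-a b a))
    ... | elsewhere x≢a x≢b = trans (swap-other x≢a x≢b) (sym (swap-other x≢b x≢a))

    swap-related : ∀ {ℓ} {_∼_ : Rel A ℓ} → IsEquivalence _∼_ → a ∼ b → ∀ x → x ∼ swap a b x
    swap-related {_∼_ = _∼_} equiv a∼b x with position a b x
    ... | at-a              = subst (a ∼_) (sym (swap-a a b)) a∼b
    ... | at-b              = subst (b ∼_) (sym (swap-b a b)) (IsEquivalence.sym equiv a∼b)
    ... | elsewhere x≢a x≢b = subst (x ∼_) (sym (swap-other x≢a x≢b)) (IsEquivalence.refl equiv)

  swap-self : ∀ {a} x → swap a a x ≡ x
  swap-self {a} x with position a a x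
  ... | at-a            = swap-a a a
  ... | at-b            = swap-a a a
  ... | elsewhere x≢a _ = swap-other x≢a x≢a

  open ≡-Reasoning

  swap-conjugate : ∀ {a b c} → a ≢ b → b ≢ c → a ≢ c →
                   ∀ x → swap a c x ≡ swap a b (swap b c (swap a b x))
  swap-conjugate {a} {b} {c} a≢b b≢c a≢c x with position a b x | position a c x
  ... | at-a | _ = begin
    swap a c a                     ≡⟨ swap-a a c ⟩
    c                              ≡⟨ swap-other (a≢c ∘ sym) (b≢c ∘ sym) ⟨
    swap a b c                     ≡⟨ cong (swap a b) (swap-a b c) ⟨
    swap a b (swap b c b)          ≡⟨ cong (swap a b ∘ swap b c) (swap-a a b) ⟨
    swap a b (swap b c (swap a b a)) ∎
  ... | at-b | _ = begin
    swap a c b                     ≡⟨ swap-other (a≢b ∘ sym) b≢c ⟩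
    b                              ≡⟨ swap-a a b ⟨
    swap a b a                     ≡⟨ cong (swap a b) (swap-other a≢b a≢c) ⟨
    swap a b (swap b c a)          ≡⟨ cong (swap a b ∘ swap b c) (swap-b a b) ⟨
    swap a b (swap b c (swap a b b)) ∎
  ... | elsewhere x≢a x≢b | at-a = ⊥-elim (x≢a refl)
  ... | elsewhere x≢a x≢b | at-b = begin
    swap a c c                     ≡⟨ swap-b a c ⟩
    a                              ≡⟨ swap-b a b ⟨
    swap a b b                     ≡⟨ cong (swap a b) (swap-b b c) ⟨
    swap a b (swap b c c)          ≡⟨ cong (swap a b ∘ swap b c) (swap-other x≢a x≢b) ⟨
    swap a b (swap b c (swap a b c)) ∎
  ... | elsewhere x≢a x≢b | elsewhere _ x≢c = begin
    swap a c x                     ≡⟨ swap-other x≢a x≢c ⟩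
    x                              ≡⟨ swap-other x≢a x≢b ⟨
    swap a b x                     ≡⟨ cong (swap a b) (swap-other x≢b x≢c) ⟨
    swap a b (swap b c x)          ≡⟨ cong (swap a b ∘ swap b c) (swap-other x≢a x≢b) ⟨
    swap a b (swap b c (swap a b x)) ∎

open module SwapFin {n : ℕ} = Swap (_≟_ {n})
module SwapPt {n : ℕ} = Swap (_≟P_ {n})

transpose≗swap : ∀ {n} (i j : Fin n) → transpose i j ≗ swap i j
transpose≗swap i j k with does (k ≟ i)
... | true  = refl
... | false with does (k ≟ j)
...   | true  = refl
...   | false = refl

inPair : ∀ {n} → Fin n → Fin n → Fin n → Bool
inPair a b y = does (y ≟ a) ∨ does (y ≟ b)

signFlip : ∀ {n} → (Fin n → Bool) → Pt n → Pt n
signFlip S (b , y) = (S y xor b , y)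

module _ {n : ℕ} where

  inPair-a : ∀ (a b : Fin n) → inPair a b a ≡ true
  inPair-a a b rewrite dec-true (a ≟ a) refl = refl

  inPair-b : ∀ (a b : Fin n) → inPair a b b ≡ true
  inPair-b a b with b ≟ a
  ... | yes _ = refl
  ... | no _ rewrite dec-true (b ≟ b) refl = refl

  inPair-other : ∀ {a b y : Fin n} → y ≢ a → y ≢ b → inPair a b y ≡ false
  inPair-other {a} {b} {y} y≢a y≢b rewrite dec-false (y ≟ a) y≢a | dec-false (y ≟ b) y≢b = refl

  inPair-∘-involution : ∀ {a b : Fin n} {σ : Fin n → Fin n} → (∀ x → σ (σ x) ≡ x) →
                        ∀ y → inPair a b (σ y) ≡ inPair (σ a) (σ b) y
  inPair-∘-involution {a} {b} {σ} σσ y = cong₂ _∨_ (moved a) (moved b)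
    where
    moved : ∀ c → does (σ y ≟ c) ≡ does (y ≟ σ c)
    moved c = does-⇔ (mk⇔ (λ e → trans (sym (σσ y)) (cong σ e)) (λ e → trans (cong σ e) (σσ c)))
                     (σ y ≟ c) (y ≟ σ c)

module _ {n : ℕ} (a b : Pt n) where

  swapPt-a : swapPt a b a ≡ b
  swapPt-a = SwapPt.swap-a a b

  swapPt-b : swapPt a b b ≡ a
  swapPt-b = SwapPt.swap-b a b

  swapPt-other : ∀ x → x ≢ a → x ≢ b → swapPt a b x ≡ x
  swapPt-other x = SwapPt.swap-other {n} {a} {b} {x}

≢-by-abs : ∀ {n} {b b′ : Bool} {y y′ : Fin n} → y ≢ y′ → _≢_ {A = Pt n} (b , y) (b′ , y′)
≢-by-abs y≢y′ e = y≢y′ (cong proj₂ e)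

module _ {n : ℕ} {i k : Fin n} (i≢k : i ≢ k) where
  private
    k≢i : k ≢ i
    k≢i = i≢k ∘ sym

    tD-via : ∀ s x {y z} → swapPt (true , i) (not s , k) x ≡ y → swapPt (false , i) (s , k) y ≡ z →
             tD i k s x ≡ z
    tD-via s x p q = trans (cong (swapPt (false , i) (s , k)) p) q

  tD-at-i : ∀ s b → tD i k s (b , i) ≡ (s xor b , k)
  tD-at-i true true = tD-via true (true , i)
    (swapPt-a (true , i) (false , k)) (swapPt-other (false , i) (true , k) (false , k) (≢-by-abs k≢i) (λ ()))
  tD-at-i true false = tD-via true (false , i)
    (swapPt-other (true , i) (false , k) (false , i) (λ ()) (≢-by-abs i≢k)) (swapPt-a (false , i) (true , k))
  tD-at-i false true = tD-via false (true , i)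
    (swapPt-a (true , i) (true , k)) (swapPt-other (false , i) (false , k) (true , k) (λ ()) (λ ()))
  tD-at-i false false = tD-via false (false , i)
    (swapPt-other (true , i) (true , k) (false , i) (λ ()) (λ ())) (swapPt-a (false , i) (false , k))

  tD-at-k : ∀ s b → tD i k s (b , k) ≡ (s xor b , i)
  tD-at-k true true = tD-via true (true , k)
    (swapPt-other (true , i) (false , k) (true , k) (≢-by-abs k≢i) (λ ())) (swapPt-b (false , i) (true , k))
  tD-at-k true false = tD-via true (false , k)
    (swapPt-b (true , i) (false , k)) (swapPt-other (false , i) (true , k) (true , i) (λ ()) (≢-by-abs i≢k))
  tD-at-k false true = tD-via false (true , k)
    (swapPt-b (true , i) (true , k)) (swapPt-other (false , i) (false , k) (true , i) (λ ()) (λ ()))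
  tD-at-k false false = tD-via false (false , k)
    (swapPt-other (true , i) (true , k) (false , k) (λ ()) (λ ())) (swapPt-b (false , i) (false , k))

  tD-elsewhere : ∀ s b {y} → y ≢ i → y ≢ k → tD i k s (b , y) ≡ (b , y)
  tD-elsewhere s b {y} y≢i y≢k = tD-via s (b , y)
    (swapPt-other (true , i) (not s , k) (b , y) (≢-by-abs y≢i) (≢-by-abs y≢k))
    (swapPt-other (false , i) (s , k) (b , y) (≢-by-abs y≢i) (≢-by-abs y≢k))

  tD-unsigned : tD i k false ≗ map₂ (swap i k)
  tD-unsigned (b , y) with position i k y
  ... | at-a              = trans (tD-at-i false b) (cong (b ,_) (sym (swap-a i k)))
  ... | at-b              = trans (tD-at-k false b) (cong (b ,_) (sym (swap-b i k)))
  ... | elsewhere y≢i y≢k = trans (tD-elsewhere false b y≢i y≢k) (cong (b ,_) (sym (swap-other y≢i y≢k)))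

  tD-signed : tD i k true ≗ (map₂ (swap i k) ∘ signFlip (inPair i k))
  tD-signed (b , y) with position i k y
  ... | at-a              = trans (tD-at-i true b) (sym (cong₂ _,_ (cong (_xor b) (inPair-a i k)) (swap-a i k)))
  ... | at-b              = trans (tD-at-k true b) (sym (cong₂ _,_ (cong (_xor b) (inPair-b i k)) (swap-b i k)))
  ... | elsewhere y≢i y≢k = trans (tD-elsewhere true b y≢i y≢k)
                                  (sym (cong₂ _,_ (cong (_xor b) (inPair-other y≢i y≢k)) (swap-other y≢i y≢k)))

φ-tD : ∀ {n} {i k : Fin n} → i ≢ k → ∀ s → φ (tD i k s) ≗ swap i k
φ-tD i≢k false y = cong proj₂ (tD-unsigned i≢k (false , y))
φ-tD i≢k true  y = cong proj₂ (tD-signed i≢k (false , y))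

Gen-map : ∀ {A : Set} {S S′ : (A → A) → Set} → (∀ {f} → S f → Gen S′ f) → ∀ {g} → Gen S g → Gen S′ g
Gen-map S⊆⟨S′⟩ (gen s)       = S⊆⟨S′⟩ s
Gen-map S⊆⟨S′⟩ unit          = unit
Gen-map S⊆⟨S′⟩ (comp f g)    = comp (Gen-map S⊆⟨S′⟩ f) (Gen-map S⊆⟨S′⟩ g)
Gen-map S⊆⟨S′⟩ (inv f gf fg) = inv (Gen-map S⊆⟨S′⟩ f) gf fg
Gen-map S⊆⟨S′⟩ (ext f f≗g)   = ext (Gen-map S⊆⟨S′⟩ f) f≗g

Gen-orbit : ∀ {A : Set} {S : (A → A) → Set} {ℓ} {_∼_ : Rel A ℓ} → IsEquivalence _∼_ →
            (∀ {f} → S f → ∀ x → x ∼ f x) → ∀ {g} → Gen S g → ∀ x → x ∼ g x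
Gen-orbit equiv moves (gen s) x = moves s x
Gen-orbit equiv moves unit x = IsEquivalence.refl equiv
Gen-orbit equiv moves (comp {g = g} f h) x =
  IsEquivalence.trans equiv (Gen-orbit equiv moves h x) (Gen-orbit equiv moves f (g x))
Gen-orbit {_∼_ = _∼_} equiv moves (inv {g = g} f _ fg) x =
  IsEquivalence.sym equiv (subst (g x ∼_) (fg x) (Gen-orbit equiv moves f (g x)))
Gen-orbit {_∼_ = _∼_} equiv moves (ext f f≗g) x = subst (x ∼_) (f≗g x) (Gen-orbit equiv moves f x)

module Graph {m n : ℕ} (A B : Fin m → Fin n) where

  data Edge (Q : Fin m → Set) : Rel (Fin n) 0ℓ where
    edge : ∀ {j} → Q j → Edge Q (A j) (B j)

  Conn : (Fin m → Set) → Rel (Fin n) 0ℓ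
  Conn Q = EqClosure (Edge Q)

  Redundant : Fin m → Set
  Redundant j = Conn (_≢ j) (A j) (B j)

  Conn-mono : ∀ {Q Q′ : Fin m → Set} → (∀ {j} → Q j → Q′ j) → Conn Q ⇒ Conn Q′
  Conn-mono Q⊆Q′ = EqClosure.map (λ { (edge q) → edge (Q⊆Q′ q) })

  bypass : ∀ {j Q} → Redundant j → Conn Q ⇒ Conn (_≢ j)
  bypass {j} {Q} redundant = reroute ⋆
    where
    reroute : Edge Q ⇒ Conn (_≢ j)
    reroute (edge {i} _) with i ≟ j
    ... | yes refl = redundant
    ... | no i≢j   = EqClosure.return (edge i≢j)

  Before : ℕ → Fin m → Set
  Before k j = toℕ j < k

  -- Kruskal's algorithm: after the first k edges every vertex is joined to its root and at
  -- most n ∸ k roots remain, so one of the first n edges joins two vertices with equal roots.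
  record Representatives (k : ℕ) : Set where
    field
      roots      : Subset n
      root       : Fin n → Fin n
      root∈roots : ∀ x → root x ∈ roots
      toRoot     : ∀ x → Conn (Before k) x (root x)
      size       : ∣ roots ∣ + k ≤ n

    same-root⇒Conn : ∀ {x y} → root x ≡ root y → Conn (Before k) x y
    same-root⇒Conn {x} {y} rx≡ry =
      toRoot x ◅◅ subst (λ r → Conn (Before k) r y) (sym rx≡ry) (EqClosure.symmetric _ (toRoot y))

  trivialRepresentatives : Representatives 0
  trivialRepresentatives = record
    { roots      = Subset.⊤
    ; root       = id
    ; root∈roots = λ _ → ∈⊤
    ; toRoot     = λ _ → ε
    ; size       = ≤-reflexive (trans (+-identityʳ _) (∣⊤∣≡n n))
    }

  merge : ∀ {k} (R : Representatives k) (j : Fin m) → toℕ j ≡ k →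
          Representatives.root R (A j) ≢ Representatives.root R (B j) → Representatives (suc k)
  merge {k} R j refl ra≢rb = record
    { roots      = roots - root b
    ; root       = root′
    ; root∈roots = root′∈roots′
    ; toRoot     = toRoot′
    ; size       = subst (_≤ n) (sym (+-suc _ k))
                     (≤-trans (+-monoˡ-≤ k (x∈p⇒∣p-x∣<∣p∣ (root∈roots b))) size)
    }
    where
    open Representatives R
    a b : Fin n
    a = A j
    b = B j

    up : Conn (Before k) ⇒ Conn (Before (suc k))
    up = Conn-mono m<n⇒m<1+n

    root′ : Fin n → Fin n
    root′ x with root x ≟ root b
    ... | yes _ = root a
    ... | no _  = root x

    root′∈roots′ : ∀ x → root′ x ∈ roots - root b
    root′∈roots′ x with root x ≟ root b
    ... | yes _     = x∈p∧x≢y⇒x∈p-y (root∈roots a) ra≢rb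
    ... | no rx≢rb = x∈p∧x≢y⇒x∈p-y (root∈roots x) rx≢rb

    toRoot′ : ∀ x → Conn (Before (suc k)) x (root′ x)
    toRoot′ x with root x ≟ root b
    ... | yes rx≡rb =
      up (same-root⇒Conn rx≡rb) ◅◅ EqClosure.symmetric _ (EqClosure.return (edge (n<1+n k))) ◅◅ up (toRoot a)
    ... | no _      = up (toRoot x)

  addEdge : ∀ {k} (R : Representatives k) (j : Fin m) → toℕ j ≡ k → ∃ Redundant ⊎ Representatives (suc k)
  addEdge {k} R j j≡k with Representatives.root R (A j) ≟ Representatives.root R (B j)
  ... | yes ra≡rb = inj₁ (j , Conn-mono before-j (Representatives.same-root⇒Conn R ra≡rb))
    where
    before-j : ∀ {i} → Before k i → i ≢ j
    before-j i<k i≡j = <-irrefl (trans (cong toℕ i≡j) j≡k) i<k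
  ... | no ra≢rb  = inj₂ (merge R j j≡k ra≢rb)

  addEdges : ∀ k → k ≤ m → ∃ Redundant ⊎ Representatives k
  addEdges zero    _   = inj₂ trivialRepresentatives
  addEdges (suc k) k<m with addEdges k (<⇒≤ k<m)
  ... | inj₁ found = inj₁ found
  ... | inj₂ R     = addEdge R (fromℕ< k<m) (toℕ-fromℕ< k<m)

  redundantEdge : n ≤ m → Fin n → ∃ Redundant
  redundantEdge n≤m v with addEdges n n≤m
  ... | inj₁ found = found
  ... | inj₂ R     = ⊥-elim (<⇒≱ (≤-<-trans z≤n (x∈p⇒∣p-x∣<∣p∣ (root∈roots v))) (+-cancelʳ-≤ n _ 0 size))
    where open Representatives R

module SignedGeneration {n : ℕ} (S : (Pt n → Pt n) → Set) where

  Swappable : Rel (Fin n) 0ℓ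
  Swappable x y = Gen S (map₂ (swap x y))

  Flippable : Fin n → Fin n → Set
  Flippable a b = Gen S (signFlip (inPair a b))

  swappable-refl : ∀ {x} → Swappable x x
  swappable-refl = ext unit (λ p → cong (proj₁ p ,_) (sym (swap-self (proj₂ p))))

  swappable-sym : ∀ {x y} → Swappable x y → Swappable y x
  swappable-sym xy = ext xy (λ p → cong (proj₁ p ,_) (swap-comm (proj₂ p)))

  swappable-trans : ∀ {x y z} → Swappable x y → Swappable y z → Swappable x z
  swappable-trans {x} {y} {z} xy yz with x ≟ z | x ≟ y | y ≟ z
  ... | yes refl | _        | _        = swappable-refl
  ... | no _     | yes refl | _        = yz
  ... | no _     | no _     | yes refl = xy
  ... | no x≢z   | no x≢y   | no y≢z   =
    ext (comp (comp xy yz) xy) (λ p → cong (proj₁ p ,_) (sym (swap-conjugate x≢y y≢z x≢z (proj₂ p))))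

  swappable-isEquivalence : IsEquivalence Swappable
  swappable-isEquivalence = record
    { refl  = swappable-refl
    ; sym   = swappable-sym
    ; trans = swappable-trans
    }

  flippable-swap : ∀ {a b c d} → Swappable c d → Flippable a b → Flippable (swap c d a) (swap c d b)
  flippable-swap {a} {b} {c} {d} σ flip-ab = ext (comp σ (comp flip-ab σ)) λ (s , y) →
    cong₂ _,_ (cong (_xor s) (inPair-∘-involution {a = a} {b} {swap c d} swap-involutive y)) (swap-involutive y)

  flippable-everywhere : (∀ x y → Swappable x y) → ∀ {i k} → i ≢ k → Flippable i k →
                         ∀ {a b} → a ≢ b → Flippable a b
  flippable-everywhere swappable {i} {k} i≢k flip-ik {a} {b} a≢b =
    subst₂ Flippable a-reached b-reached
      (flippable-swap (swappable b k) (flippable-swap (swappable a′ i) flip-ik))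
    where
    a′ : Fin n
    a′ = swap b k a

    k≢a′ : k ≢ a′
    k≢a′ k≡a′ = a≢b (trans (sym (swap-involutive a)) (trans (cong (swap b k) (sym k≡a′)) (swap-b b k)))

    a-reached : swap b k (swap a′ i i) ≡ a
    a-reached = trans (cong (swap b k) (swap-b a′ i)) (swap-involutive a)

    b-reached : swap b k (swap a′ i k) ≡ b
    b-reached = trans (cong (swap b k) (swap-other k≢a′ (i≢k ∘ sym))) (swap-b b k)

record OrderedSwap {n : ℕ} (f : Fin n → Fin n) : Set where
  field
    lo hi  : Fin n
    lo<hi  : toℕ lo < toℕ hi
    f≗swap : f ≗ swap lo hi

IsTransposition⇒OrderedSwap : ∀ {n} {f : Fin n → Fin n} → IsTransposition f → OrderedSwap f
IsTransposition⇒OrderedSwap (i , j , i≢j , f≗) with <-cmp i j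
... | tri< i<j _ _ = record { lo<hi = i<j ; f≗swap = λ x → trans (f≗ x) (transpose≗swap i j x) }
... | tri≈ _ i≡j _ = ⊥-elim (i≢j i≡j)
... | tri> _ _ j<i = record
  { lo<hi = j<i ; f≗swap = λ x → trans (f≗ x) (trans (transpose≗swap i j x) (swap-comm x)) }

generated⇒connected : ∀ {n} {s : Fin n → Fin n → Fin n} (τ : ∀ k → OrderedSwap (s k)) →
                      (∀ g → IsBijection g → Gen (Entries s) g) →
                      ∀ x y → Graph.Conn (OrderedSwap.lo ∘ τ) (OrderedSwap.hi ∘ τ) (λ _ → ⊤) x y
generated⇒connected {s = s} τ generates x y =
  subst (Conn _ x) (swap-a x y)
    (Gen-orbit (EqClosure.isEquivalence _) moves
      (generates (swap x y) (swap x y , swap-involutive , swap-involutive)) x)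
  where
  open Graph (OrderedSwap.lo ∘ τ) (OrderedSwap.hi ∘ τ)

  moves : ∀ {f} → Entries s f → ∀ z → Conn (λ _ → ⊤) z (f z)
  moves (k , sk≗f) z = subst (Conn _ z) (trans (sym (OrderedSwap.f≗swap (τ k) z)) (sk≗f z))
                         (swap-related (EqClosure.isEquivalence _) (EqClosure.return (edge tt)) z)

module SignedLift {n : ℕ} (lo hi : Fin n → Fin n) (lo<hi : ∀ k → toℕ (lo k) < toℕ (hi k))
                  (m : Fin n) (spanning : ∀ x y → Graph.Conn lo hi (_≢ m) x y) where

  t : Fin n → Pt n → Pt n
  t k = tD (lo k) (hi k) (does (k ≟ m))

  t∈TD : ∀ k → InTD (t k)
  t∈TD k = lo k , hi k , does (k ≟ m) , lo<hi k , λ _ → refl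

  ⟨t⟩⊆SD : ∀ {g} → Gen (Entries t) g → InSD g
  ⟨t⟩⊆SD = Gen-map (λ (k , tk≗f) → ext (gen (t∈TD k)) tk≗f)

  private
    lo≢hi : ∀ k → lo k ≢ hi k
    lo≢hi k = <⇒≢ (lo<hi k)

  t-unsigned : ∀ {k} → k ≢ m → t k ≗ map₂ (swap (lo k) (hi k))
  t-unsigned {k} k≢m rewrite dec-false (k ≟ m) k≢m = tD-unsigned (lo≢hi k)

  t-signed : t m ≗ (map₂ (swap (lo m) (hi m)) ∘ signFlip (inPair (lo m) (hi m)))
  t-signed rewrite dec-true (m ≟ m) refl = tD-signed (lo≢hi m)

  φ-t : ∀ k → φ (t k) ≗ swap (lo k) (hi k)
  φ-t k = φ-tD (lo≢hi k) (does (k ≟ m))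

  open SignedGeneration (Entries t)
  open Graph lo hi

  swappable : ∀ x y → Swappable x y
  swappable x y = EqClosure.fold swappable-isEquivalence unsigned-edge (spanning x y)
    where
    unsigned-edge : Edge (_≢ m) ⇒ Swappable
    unsigned-edge (edge {k} k≢m) = ext (gen (k , λ _ → refl)) (t-unsigned k≢m)

  flippable : ∀ {a b} → a ≢ b → Flippable a b
  flippable = flippable-everywhere swappable (lo≢hi m) flippable-m
    where
    flippable-m : Flippable (lo m) (hi m)
    flippable-m = ext (comp (swappable (lo m) (hi m)) (gen (m , λ _ → refl))) λ (b , y) →
      trans (cong (map₂ (swap (lo m) (hi m))) (t-signed (b , y)))
            (cong (inPair (lo m) (hi m) y xor b ,_) (swap-involutive y))

  TD⊆⟨t⟩ : ∀ {f} → InTD f → Gen (Entries t) f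
  TD⊆⟨t⟩ (i , k , false , i<k , f≗) =
    ext (swappable i k) (λ p → sym (trans (f≗ p) (tD-unsigned (<⇒≢ i<k) p)))
  TD⊆⟨t⟩ (i , k , true , i<k , f≗) =
    ext (comp (swappable i k) (flippable (<⇒≢ i<k))) (λ p → sym (trans (f≗ p) (tD-signed (<⇒≢ i<k) p)))

  t∈Ξ : InXiD n t
  t∈Ξ = t∈TD , λ _ → Gen-map TD⊆⟨t⟩ , ⟨t⟩⊆SD

proposition2p25 : (n : ℕ) → 4 ≤ n → (s : Fin n → (Fin n → Fin n)) → InXiSym n s →
    Σ (Fin n → (Pt n → Pt n)) (λ t → InXiD n t × (∀ k → φ (t k) ≗ s k))
proposition2p25 (suc n) _ s (transpositions , generates) =
  t , t∈Ξ , λ k y → trans (φ-t k y) (sym (τ.f≗swap k y))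
  where
  ordered : ∀ k → OrderedSwap (s k)
  ordered k = IsTransposition⇒OrderedSwap (transpositions k)

  module τ k = OrderedSwap (ordered k)
  open Graph τ.lo τ.hi

  redundant : ∃ Redundant
  redundant = redundantEdge ≤-refl fzero

  open SignedLift τ.lo τ.hi τ.lo<hi (proj₁ redundant)
                  (λ x y → bypass (proj₂ redundant) (generated⇒connected ordered generates x y))
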